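{- Let $L\subseteq A^*$ be a regular language, $\mathbf{M}_L$ its syntactic monoid and $h:A^*\to\mathbf{M}_L$ the canonical projection. Then $L$ is monotone if and only if there is an order $\le_{\mathbf{M}_L}$ on $\mathbf{M}_L$, compatible with the product and included in the syntactic order $\le_L$, such that for all $u,v\in A^*$, $u\le_{A^*}v$ implies $h(u)\le_{\mathbf{M}_L}h(v)$.
   Context: Let $\Sigma$ be a finite set of unary predicates and $A=2^\Sigma$. For words $u,v\in A^*$, $u\le_{A^*}v$ iff $|u|=|v|$ and the $i$-th letter of $u$ is a subset of the $i$-th letter of $v$ for every $i$. $L$ is monotone if $u\in L$ and $u\le_{A^*}v$ imply $v\in L$. For $u,v\in A^*$, $u\sim_L v$ iff for all $x,y\in A^*$, $xuy\in L\Leftrightarrow xvy\in L$; $u\le_L v$ iff for all $x,y\in A^*$, $xuy\in L\Rightarrow xvy\in L$. The syntactic monoid is $\mathbf{M}_L=A^*/\sim_L$ with concatenation, and $\le_L$ induces an order on $\mathbf{M}_L$ (the syntactic order, also denoted $\le_L$). An order $\le$ on a monoid is compatible with the product if $m\le n$ and $m'\le n'$ imply $mm'\le nn'$. -}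

module Defs where

open import Data.Nat using (ℕ)
open import Data.Fin using (Fin)
open import Data.Fin.Subset using (Subset; _⊆_)
open import Data.Bool using (Bool; true)
open import Data.List using (List; []; _∷_; _++_; foldl)
open import Data.List.Relation.Binary.Pointwise using (Pointwise)
open import Data.Product using (Σ; _×_)
open import Relation.Binary.PropositionalEquality using (_≡_)
open import Function.Bundles using (_⇔_)

-- Σ = Fin n (n unary predicates); the alphabet A = 2^Σ is Subset n.
Letter : ℕ → Set
Letter n = Subset n

Word : ℕ → Set
Word n = List (Letter n)

Language : ℕ → Set₁
Language n = Word n → Set

_≤A_ : ∀ {n} → Word n → Word n → Set
u ≤A v = Pointwise _⊆_ u v

record DFA (n : ℕ) : Set where
  field
    states    : ℕ
    initial   : Fin states
    δ         : Fin states → Letter n → Fin states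
    accepting : Fin states → Bool

run : ∀ {n} (D : DFA n) → Fin (DFA.states D) → Word n → Fin (DFA.states D)
run D q w = foldl (DFA.δ D) q w

Regular : ∀ {n} → Language n → Set
Regular {n} L = Σ (DFA n) λ D →
  ∀ w → L w ⇔ (DFA.accepting D (run D (DFA.initial D) w) ≡ true)

Monotone : ∀ {n} → Language n → Set
Monotone L = ∀ u v → L u → u ≤A v → L v

_∼[_]_ : ∀ {n} → Word n → Language n → Word n → Set
u ∼[ L ] v = ∀ x y → L (x ++ u ++ y) ⇔ L (x ++ v ++ y)

_≤[_]_ : ∀ {n} → Word n → Language n → Word n → Set
u ≤[ L ] v = ∀ x y → L (x ++ u ++ y) → L (x ++ v ++ y)

-- The syntactic monoid M_L = A*/∼_L is represented as the setoid (A*, ∼_L);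
-- the canonical projection h is then the identity on representatives.
record IsOrderOnML {n} (L : Language n) (R : Word n → Word n → Set) : Set where
  field
    respects : ∀ {u u' v v'} → u ∼[ L ] u' → v ∼[ L ] v' → R u v → R u' v'
    refl     : ∀ u → R u u
    trans    : ∀ {u v w} → R u v → R v w → R u w
    antisym  : ∀ {u v} → R u v → R v u → u ∼[ L ] v

CompatibleWithProduct : ∀ {n} → (Word n → Word n → Set) → Set
CompatibleWithProduct R = ∀ {m n m' n'} → R m n → R m' n' → R (m ++ m') (n ++ n')

IncludedInSyntacticOrder : ∀ {n} (L : Language n) → (Word n → Word n → Set) → Set
IncludedInSyntacticOrder L R = ∀ {u v} → R u v → u ≤[ L ] v

{-# OPTIONS --safe #-}

-- The syntactic order ≤_L is itself an order on M_L compatible with the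
-- product.  Since ≤_{A*} is preserved by concatenation with arbitrary
-- contexts, L is monotone exactly when ≤_{A*} ⊆ ≤_L, so ≤_L is the required
-- order.  Conversely, any such order R gives ≤_{A*} ⊆ R ⊆ ≤_L, and ≤_L in the
-- empty context says L u → L v.
module Submission where

open import Defs
open import Data.Nat using (ℕ)
open import Data.List using ([]; _++_)
open import Data.List.Properties using (++-assoc; ++-identityʳ)
open import Data.List.Relation.Binary.Pointwise as Pointwise using ()
open import Data.Product using (Σ; _×_; _,_)
open import Function.Bundles using (_⇔_; mk⇔; Equivalence)
open import Relation.Binary.PropositionalEquality using (_≡_; cong; subst; sym)

≤A-refl : ∀ {n} {w : Word n} → w ≤A w
≤A-refl = Pointwise.refl (λ {_} {_} x∈ → x∈)

≤A-++-context : ∀ {n} {u v : Word n} x y → u ≤A v → (x ++ u ++ y) ≤A (x ++ v ++ y)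
≤A-++-context x y u≤v = Pointwise.++⁺ (≤A-refl {w = x}) (Pointwise.++⁺ u≤v (≤A-refl {w = y}))

module _ {n : ℕ} (L : Language n) where

  ≤[]-isOrderOnML : IsOrderOnML L (_≤[ L ]_)
  ≤[]-isOrderOnML = record
    { respects = λ u∼u' v∼v' u≤v x y p →
        Equivalence.to (v∼v' x y) (u≤v x y (Equivalence.from (u∼u' x y) p))
    ; refl     = λ _ _ _ p → p
    ; trans    = λ u≤v v≤w x y p → v≤w x y (u≤v x y p)
    ; antisym  = λ u≤v v≤u x y → mk⇔ (u≤v x y) (v≤u x y)
    }

  ≤[]-++ʳ : ∀ {u v} w → u ≤[ L ] v → (u ++ w) ≤[ L ] (v ++ w)
  ≤[]-++ʳ {u} {v} w u≤v x y p =
    subst L (sym (cong (x ++_) (++-assoc v w y)))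
      (u≤v x (w ++ y) (subst L (cong (x ++_) (++-assoc u w y)) p))

  ≤[]-++ˡ : ∀ {u v} w → u ≤[ L ] v → (w ++ u) ≤[ L ] (w ++ v)
  ≤[]-++ˡ {u} {v} w u≤v x y p =
    subst L (sym (reassoc v)) (u≤v (x ++ w) y (subst L (reassoc u) p))
    where
    reassoc : ∀ z → x ++ (w ++ z) ++ y ≡ (x ++ w) ++ z ++ y
    reassoc z rewrite ++-assoc w z y = sym (++-assoc x w (z ++ y))

  ≤[]-compatibleWithProduct : CompatibleWithProduct (_≤[ L ]_)
  ≤[]-compatibleWithProduct {u} {v} {u'} {v'} u≤v u'≤v' x y p =
    ≤[]-++ˡ v u'≤v' x y (≤[]-++ʳ u' u≤v x y p)

  ≤[]-emptyContext : ∀ {u v} → u ≤[ L ] v → L u → L v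
  ≤[]-emptyContext {u} {v} u≤v p =
    subst L (++-identityʳ v) (u≤v [] [] (subst L (sym (++-identityʳ u)) p))

  monotone⇒≤A⊆≤[] : Monotone L → ∀ u v → u ≤A v → u ≤[ L ] v
  monotone⇒≤A⊆≤[] mono u v u≤v x y p = mono _ _ p (≤A-++-context x y u≤v)

  MonotoneOrderOnML : (Word n → Word n → Set) → Set
  MonotoneOrderOnML R =
    IsOrderOnML L R × CompatibleWithProduct R × IncludedInSyntacticOrder L R ×
    (∀ u v → u ≤A v → R u v)

  monotone⇒≤[]-monotoneOrderOnML : Monotone L → MonotoneOrderOnML (_≤[ L ]_)
  monotone⇒≤[]-monotoneOrderOnML mono =
    ≤[]-isOrderOnML , ≤[]-compatibleWithProduct , (λ u≤v → u≤v) ,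
    monotone⇒≤A⊆≤[] mono

  monotoneOrderOnML⇒monotone : ∀ {R} → MonotoneOrderOnML R → Monotone L
  monotoneOrderOnML⇒monotone (_ , _ , R⊆≤[] , ≤A⊆R) u v p u≤v =
    ≤[]-emptyContext (R⊆≤[] (≤A⊆R u v u≤v)) p

lemma29 : (n : ℕ) (L : Language n) → Regular L →
    Monotone L ⇔
      Σ (Word n → Word n → Set) λ R →
        IsOrderOnML L R × CompatibleWithProduct R × IncludedInSyntacticOrder L R ×
        (∀ u v → u ≤A v → R u v)
lemma29 n L _ = mk⇔
  (λ mono → _≤[ L ]_ , monotone⇒≤[]-monotoneOrderOnML L mono)
  (λ (_ , isMonotoneOrder) → monotoneOrderOnML⇒monotone L isMonotoneOrder)
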